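{- Let $L$ be a vocabulary with maximum relation arity $k$, let $K$ and $M$ be $L$-structures, $v\in V(M)$ and $t\ge0$ an integer. The following three conditions are equivalent. (A) $V(M)\subseteq V(K)$, $|V(K)|=|V(M)|+t$; $K[V(M)]=M$; $|[v]_M|\ge k$; and $[v]_K=[v]_M\cup(V(K)\setminus V(M))$. (B) $V(M)\subseteq V(K)$, $|V(K)|=|V(M)|+t$; and there is $C\subseteq[v]_M$ with $|C|\ge k$ such that every injective map $\psi:V(M)\to V(K)$ that is the identity on $V(M)\setminus C$ is a partial isomorphism from $M$ to $K$. (C) $V(M)\subseteq V(K)$, $|V(K)|=|V(M)|+t$; $|[v]_M|\ge k$; for every $l$-ary symbol $R\in L$ and $\bar u\in V(M)^l$, $R^K\bar u=R^M\bar u$; and for every $l$-ary $R\in L$ and every $\bar u=(u_1,\ldots,u_l)\in V(K)^l$ such that $\{u_1,\ldots,u_l\}\setminus V(M)=\{w_1,\ldots,w_p\}$ (with $w_1,\ldots,w_p$ pairwise distinct) is nonempty, $R^K\bar u=1$ if and only if there are pairwise distinct $v_1,\ldots,v_p\in[v]_M\setminus\{u_1,\ldots,u_l\}$ such that $R^M\pi\bar u=1$ for $\pi=(w_1v_1)\cdots(w_pv_p)$.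
   Context: An $L$-structure $M$ has a finite universe $V(M)$ and relations $R^M:V(M)^l\to\{0,1\}$ for each $l$-ary symbol. $M[U]$ is the induced substructure on $U$. A partial isomorphism from $M$ to $K$ is an injective map $\phi$ from a subset $U\subseteq V(M)$ onto $W\subseteq V(K)$ which is an isomorphism from $M[U]$ to $K[W]$. For a structure $N$ and $a,b\in V(N)$, $a\sim b$ means the transposition of $a$ and $b$ is an automorphism of $N$, and $[v]_N=\{u\in V(N):u\sim v\}$. $(wv)$ denotes the transposition of $w$ and $v$; a map $\pi$ acts on tuples coordinatewise, $\pi(u_1,\ldots,u_l)=(\pi(u_1),\ldots,\pi(u_l))$. -}

module Defs where

open import Data.Nat using (ℕ; _≡ᵇ_; _≤_; _<_; _+_)
open import Data.Bool using (Bool; true; if_then_else_)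
open import Data.List using (List; length)
open import Data.List.Membership.Propositional using (_∈_; _∉_)
open import Data.List.Relation.Unary.All using (All)
open import Data.List.Relation.Unary.Unique.Propositional using (Unique)
open import Data.Vec using (Vec; []; _∷_; map; lookup)
import Data.Vec.Relation.Unary.All as VAll
open import Data.Vec.Membership.Propositional using () renaming (_∈_ to _∈ᵥ_)
open import Data.Fin using (Fin)
open import Data.Product using (Σ; _×_; ∃)
open import Data.Sum using (_⊎_)
open import Function using (id; _∘_; _⇔_)
open import Relation.Binary.PropositionalEquality using (_≡_)
open import Relation.Nullary using (¬_)

record Vocabulary : Set₁ where
  field
    Sym   : Set
    arity : Sym → ℕ
open Vocabulary public

MaxArity : Vocabulary → ℕ → Set
MaxArity L k = (∀ (R : Sym L) → arity L R ≤ k) × Σ (Sym L) (λ R → arity L R ≡ k)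

-- An L-structure: finite universe (a duplicate-free list of natural numbers,
-- all structures live inside the common ambient set ℕ) and for each symbol R
-- a 0/1-valued relation on l-tuples; values on tuples outside V(M)^l are
-- irrelevant (never consulted).
record Structure (L : Vocabulary) : Set where
  field
    dom  : List ℕ
    uniq : Unique dom
    rel  : (R : Sym L) → Vec ℕ (arity L R) → Bool
open Structure public

InDom : ∀ {L} (N : Structure L) {l} → Vec ℕ l → Set
InDom N ū = VAll.All (_∈ dom N) ū

swap : ℕ → ℕ → ℕ → ℕ
swap a b x = if x ≡ᵇ a then b else (if x ≡ᵇ b then a else x)

Sim : ∀ {L} (N : Structure L) → ℕ → ℕ → Set
Sim {L} N a b = a ∈ dom N × b ∈ dom N ×
  (∀ (R : Sym L) (ū : Vec ℕ (arity L R)) → InDom N ū →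
     rel N R (map (swap a b) ū) ≡ rel N R ū)

InClass : ∀ {L} (N : Structure L) → ℕ → ℕ → Set
InClass N v u = u ∈ dom N × Sim N u v

AtLeast : ℕ → (ℕ → Set) → Set
AtLeast k P = Σ (List ℕ) λ xs → Unique xs × All P xs × k ≤ length xs

PartialIso : ∀ {L} (M K : Structure L) → List ℕ → (ℕ → ℕ) → Set
PartialIso {L} M K U φ =
  All (_∈ dom M) U ×
  (∀ {u} → u ∈ U → φ u ∈ dom K) ×
  (∀ {u u'} → u ∈ U → u' ∈ U → φ u ≡ φ u' → u ≡ u') ×
  (∀ (R : Sym L) (ū : Vec ℕ (arity L R)) → VAll.All (_∈ U) ū →
     rel K R (map φ ū) ≡ rel M R ū)

Extends : ∀ {L} (K M : Structure L) → ℕ → Set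
Extends K M t = (∀ {u} → u ∈ dom M → u ∈ dom K) × length (dom K) ≡ length (dom M) + t

-- R^K ū = R^M ū for all ū ∈ V(M)^l  (i.e. K[V(M)] = M, given V(M) ⊆ V(K))
AgreeOn : ∀ {L} (K M : Structure L) → Set
AgreeOn {L} K M = ∀ (R : Sym L) (ū : Vec ℕ (arity L R)) → InDom M ū → rel K R ū ≡ rel M R ū

Distinct : ∀ {p} → Vec ℕ p → Set
Distinct {p} ws = ∀ (i j : Fin p) → lookup ws i ≡ lookup ws j → i ≡ j

perm : ∀ {p} → Vec ℕ p → Vec ℕ p → ℕ → ℕ
perm [] [] = id
perm (w ∷ ws) (y ∷ ys) = swap w y ∘ perm ws ys

CondA : ∀ {L} → ℕ → (K M : Structure L) → ℕ → ℕ → Set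
CondA k K M v t =
  Extends K M t × AgreeOn K M × AtLeast k (InClass M v) ×
  (∀ u → InClass K v u ⇔ (InClass M v u ⊎ (u ∈ dom K × u ∉ dom M)))

CondB : ∀ {L} → ℕ → (K M : Structure L) → ℕ → ℕ → Set
CondB k K M v t =
  Extends K M t ×
  Σ (List ℕ) λ C → Unique C × All (InClass M v) C × k ≤ length C ×
    (∀ (ψ : ℕ → ℕ) →
       (∀ {u} → u ∈ dom M → ψ u ∈ dom K) →
       (∀ {u u'} → u ∈ dom M → u' ∈ dom M → ψ u ≡ ψ u' → u ≡ u') →
       (∀ {u} → u ∈ dom M → u ∉ C → ψ u ≡ u) →
       PartialIso M K (dom M) ψ)

CondC : ∀ {L} → ℕ → (K M : Structure L) → ℕ → ℕ → Set
CondC {L} k K M v t =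
  Extends K M t × AtLeast k (InClass M v) × AgreeOn K M ×
  (∀ (R : Sym L) (ū : Vec ℕ (arity L R)) → InDom K ū →
   ∀ (p : ℕ) (ws : Vec ℕ p) → Distinct ws →
   (∀ x → x ∈ᵥ ws ⇔ (x ∈ᵥ ū × x ∉ dom M)) → 0 < p →
   (rel K R ū ≡ true ⇔
     Σ (Vec ℕ p) λ vs → Distinct vs ×
       VAll.All (λ y → InClass M v y × ¬ (y ∈ᵥ ū)) vs ×
       rel M R (map (perm ws vs) ū) ≡ true))

-- Call π a renaming of a tuple ū of K if it is injective on ū, fixes the entries lying in V(M)
-- and sends the remaining (new) entries into [v]_M. Transpositions of two elements of [v]_M are
-- automorphisms of M, and two renamings of ū can be turned into each other one entry at a time by
-- such transpositions, so R^M(πū) does not depend on the renaming π; renamings exist because the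
-- arity bound k ≤ |[v]_M| leaves enough class elements outside ū. The pivot is condition (D):
-- R^K ū = R^M(πū) for every tuple ū of K and every renaming π. Condition (C) is (D) for the
-- renamings (w₁ v₁)⋯(w_p v_p), and (B) implies (D) by applying the partial isomorphism to such an
-- involution with all vᵢ ∈ C. Conversely (D) gives (A): for u ∈ [v]_M or u new, the transposition
-- (u v) permutes the entries of ū that are new or in [v]_M and fixes the others, so it changes a
-- renamed tuple only inside [v]_M. Finally (A) implies (B) directly, since ψ moves the points of C
-- only inside [v]_K.

module Submission where

open import Defs
open import Data.Nat using (ℕ; zero; suc; _≤_; _+_; z≤n; s≤s; s≤s⁻¹)
open import Data.Nat.Properties using (_≟_; +-comm; +-suc; +-monoˡ-≤; ≤-trans; module ≤-Reasoning)
open import Data.Bool.Properties using (⇔→≡)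
open import Data.Empty using (⊥-elim)
open import Data.List using (List; []; _∷_; length; _++_)
open import Data.List.Properties using (length-++; length-removeAt′)
open import Data.List.Membership.Propositional using (_∈_; _∉_; _─_)
open import Data.List.Membership.Propositional.Properties using (∈-++⁻)
open import Data.List.Membership.DecPropositional _≟_ using (_∈?_)
open import Data.List.Relation.Unary.Any using (here; there; index)
import Data.List.Relation.Unary.All as LAll
open import Data.List.Relation.Unary.Unique.Propositional using (Unique)
open import Data.List.Relation.Unary.AllPairs using ([]; _∷_)
import Data.List.Relation.Unary.Unique.Propositional.Properties as Unique
open import Data.Vec using (Vec; []; _∷_; map; toList)
open import Data.Vec.Properties using (map-∘; map-id; length-toList; tabulate∘lookup)
open import Data.Vec.Relation.Unary.Any using (here; there)
import Data.Vec.Relation.Unary.All as VAll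
open VAll using ([]; _∷_)
open import Data.Vec.Relation.Unary.All.Properties using (toList⁺; lookup⁻) renaming (map⁺ to All-map⁺)
open import Data.Vec.Relation.Unary.Unique.Propositional using ([]; _∷_) renaming (Unique to Uniqueᵥ)
open import Data.Vec.Relation.Unary.Unique.Propositional.Properties using (lookup-injective; tabulate⁺)
open import Data.Vec.Membership.Propositional using () renaming (_∈_ to _∈ᵥ_; _∉_ to _∉ᵥ_)
open import Data.Vec.Membership.Propositional.Properties using (∈-map⁺; ∈-toList⁺; ∈-toList⁻; ∈-lookup)
open import Data.Vec.Membership.DecPropositional _≟_ using () renaming (_∈?_ to _∈ᵥ?_)
open import Data.Product as Product using (Σ; ∃; _×_; _,_; proj₁; proj₂)
open import Data.Sum using (_⊎_; inj₁; inj₂)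
open import Function using (id; _∘_; _⇔_; mk⇔; Equivalence)
open Equivalence using (to; from)
open import Function.Definitions using (Injective)
open import Relation.Binary.PropositionalEquality
open import Relation.Nullary using (yes; no)
open import Relation.Nullary.Decidable using (dec-true; dec-false)

involutive⇒injective : ∀ {f : ℕ → ℕ} → (∀ x → f (f x) ≡ x) → Injective _≡_ _≡_ f
involutive⇒injective {f} inv {x} {y} eq = trans (sym (inv x)) (trans (cong f eq) (inv y))

-- does (x ≟ a) computes to the test x ≡ᵇ a inside swap, so dec-true/dec-false evaluate swap.
swap-ˡ : ∀ a b → swap a b a ≡ b
swap-ˡ a b rewrite dec-true (a ≟ a) refl = refl

swap-fix : ∀ {a b x} → x ≢ a → x ≢ b → swap a b x ≡ x
swap-fix {a} {b} {x} x≢a x≢b rewrite dec-false (x ≟ a) x≢a | dec-false (x ≟ b) x≢b = refl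

swap-ʳ : ∀ a b → swap a b b ≡ a
swap-ʳ a b with b ≟ a
... | yes refl = swap-ˡ a a
... | no b≢a rewrite dec-false (b ≟ a) b≢a | dec-true (b ≟ b) refl = refl

swap-involutive : ∀ a b x → swap a b (swap a b x) ≡ x
swap-involutive a b x with x ≟ a | x ≟ b
... | yes refl | _ = trans (cong (swap x b) (swap-ˡ x b)) (swap-ʳ x b)
... | no _ | yes refl = trans (cong (swap a x) (swap-ʳ a x)) (swap-ˡ a x)
... | no x≢a | no x≢b = trans (cong (swap a b) (swap-fix x≢a x≢b)) (swap-fix x≢a x≢b)

swap-injective : ∀ a b → Injective _≡_ _≡_ (swap a b)
swap-injective a b = involutive⇒injective (swap-involutive a b)

swap-comm : ∀ a b x → swap a b x ≡ swap b a x
swap-comm a b x with x ≟ a | x ≟ b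
... | yes refl | _ = trans (swap-ˡ x b) (sym (swap-ʳ b x))
... | no _ | yes refl = trans (swap-ʳ a x) (sym (swap-ˡ x a))
... | no x≢a | no x≢b = trans (swap-fix x≢a x≢b) (sym (swap-fix x≢b x≢a))

swap-self : ∀ a x → swap a a x ≡ x
swap-self a x with x ≟ a
... | yes refl = swap-ˡ x x
... | no x≢a = swap-fix x≢a x≢a

swap-preserves : ∀ (P : ℕ → Set) {a b x} → P a → P b → P x → P (swap a b x)
swap-preserves P {a} {b} {x} pa pb px with x ≟ a | x ≟ b
... | yes refl | _ = subst P (sym (swap-ˡ x b)) pb
... | no _ | yes refl = subst P (sym (swap-ʳ a x)) pa
... | no x≢a | no x≢b = subst P (sym (swap-fix x≢a x≢b)) px

swap-conjugate : ∀ {a b c} → a ≢ b → a ≢ c → b ≢ c →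
  ∀ x → swap a c x ≡ swap a b (swap b c (swap a b x))
swap-conjugate {a} {b} {c} a≢b a≢c b≢c x with x ≟ a | x ≟ b | x ≟ c
... | yes refl | _ | _ = begin
  swap x c x                            ≡⟨ swap-ˡ x c ⟩
  c                                     ≡⟨ swap-fix (a≢c ∘ sym) (b≢c ∘ sym) ⟨
  swap x b c                            ≡⟨ cong (swap x b) (swap-ˡ b c) ⟨
  swap x b (swap b c b)                 ≡⟨ cong (swap x b ∘ swap b c) (swap-ˡ x b) ⟨
  swap x b (swap b c (swap x b x))      ∎
  where open ≡-Reasoning
... | no x≢a | yes refl | _ = begin
  swap a c x                            ≡⟨ swap-fix x≢a b≢c ⟩
  x                                     ≡⟨ swap-ˡ a x ⟨
  swap a x a                            ≡⟨ cong (swap a x) (swap-fix a≢b a≢c) ⟨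
  swap a x (swap x c a)                 ≡⟨ cong (swap a x ∘ swap x c) (swap-ʳ a x) ⟨
  swap a x (swap x c (swap a x x))      ∎
  where open ≡-Reasoning
... | no x≢a | no x≢b | yes refl = begin
  swap a x x                            ≡⟨ swap-ʳ a x ⟩
  a                                     ≡⟨ swap-ʳ a b ⟨
  swap a b b                            ≡⟨ cong (swap a b) (swap-ʳ b x) ⟨
  swap a b (swap b x x)                 ≡⟨ cong (swap a b ∘ swap b x) (swap-fix x≢a x≢b) ⟨
  swap a b (swap b x (swap a b x))      ∎
  where open ≡-Reasoning
... | no x≢a | no x≢b | no x≢c = begin
  swap a c x                            ≡⟨ swap-fix x≢a x≢c ⟩
  x                                     ≡⟨ swap-fix x≢a x≢b ⟨
  swap a b x                            ≡⟨ cong (swap a b) (swap-fix x≢b x≢c) ⟨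
  swap a b (swap b c x)                 ≡⟨ cong (swap a b ∘ swap b c) (swap-fix x≢a x≢b) ⟨
  swap a b (swap b c (swap a b x))      ∎
  where open ≡-Reasoning

swap-natural : ∀ {f : ℕ → ℕ} {a b} → Injective _≡_ _≡_ f → f a ≡ a → f b ≡ b →
  ∀ x → f (swap a b x) ≡ swap a b (f x)
swap-natural {f} {a} {b} f-inj fa fb x with x ≟ a | x ≟ b
... | yes refl | _ = trans (cong f (swap-ˡ x b)) (trans fb (sym (trans (cong (swap x b) fa) (swap-ˡ x b))))
... | no _ | yes refl = trans (cong f (swap-ʳ a x)) (trans fa (sym (trans (cong (swap a x) fb) (swap-ʳ a x))))
... | no x≢a | no x≢b = trans (cong f (swap-fix x≢a x≢b))
  (sym (swap-fix (λ fx≡a → x≢a (f-inj (trans fx≡a (sym fa)))) (λ fx≡b → x≢b (f-inj (trans fx≡b (sym fb))))))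

InjectiveOn : ∀ {l} → (ℕ → ℕ) → Vec ℕ l → Set
InjectiveOn f ū = ∀ {x y} → x ∈ᵥ ū → y ∈ᵥ ū → f x ≡ f y → x ≡ y

map-cong-∈ : ∀ {l} {f g : ℕ → ℕ} (ū : Vec ℕ l) → (∀ {x} → x ∈ᵥ ū → f x ≡ g x) → map f ū ≡ map g ū
map-cong-∈ [] _ = refl
map-cong-∈ (x ∷ ū) f≗g = cong₂ _∷_ (f≗g (here refl)) (map-cong-∈ ū (f≗g ∘ there))

map-fix-∈ : ∀ {l} {f : ℕ → ℕ} (ū : Vec ℕ l) → (∀ {x} → x ∈ᵥ ū → f x ≡ x) → map f ū ≡ ū
map-fix-∈ ū fix = trans (map-cong-∈ ū fix) (map-id ū)

∉⇒All≢ : ∀ {n} {w} {ws : Vec ℕ n} → w ∉ᵥ ws → VAll.All (w ≢_) ws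
∉⇒All≢ {ws = []} _ = []
∉⇒All≢ {ws = _ ∷ _} w∉ws = (w∉ws ∘ here) ∷ ∉⇒All≢ (w∉ws ∘ there)

head-∉ : ∀ {n} {w} {ws : Vec ℕ n} → Uniqueᵥ (w ∷ ws) → w ∉ᵥ ws
head-∉ (w≢ws ∷ _) w∈ws = VAll.lookup w≢ws w∈ws refl

Unique-toList : ∀ {n} {ws : Vec ℕ n} → Uniqueᵥ ws → Unique (toList ws)
Unique-toList [] = []
Unique-toList (w≢ws ∷ ws-unique) = toList⁺ w≢ws ∷ Unique-toList ws-unique

Distinct⇒Unique : ∀ {n} {ws : Vec ℕ n} → Distinct ws → Uniqueᵥ ws
Distinct⇒Unique {ws = ws} distinct = subst Uniqueᵥ (tabulate∘lookup ws) (tabulate⁺ (distinct _ _))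

Unique⇒Distinct : ∀ {n} {ws : Vec ℕ n} → Uniqueᵥ ws → Distinct ws
Unique⇒Distinct = lookup-injective

∈-─ : ∀ {x y} {ys : List ℕ} (x∈ys : x ∈ ys) → y ∈ ys → y ≢ x → y ∈ ys ─ x∈ys
∈-─ (here refl) (here refl) y≢x = ⊥-elim (y≢x refl)
∈-─ (here _) (there y∈ys) _ = y∈ys
∈-─ (there _) (here refl) _ = here refl
∈-─ (there x∈ys) (there y∈ys) y≢x = there (∈-─ x∈ys y∈ys y≢x)

-- An element of xs lying in ys is charged to one entry of ys, which is then removed.
∃-unique-outside : ∀ n (xs ys : List ℕ) → Unique xs → n + length ys ≤ length xs →
  Σ (Vec ℕ n) λ zs → Uniqueᵥ zs × VAll.All (λ z → z ∈ xs × z ∉ ys) zs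
∃-unique-outside zero _ _ _ _ = [] , [] , []
∃-unique-outside (suc n) (x ∷ xs) ys (x≢xs ∷ xs-unique) n+ys≤ with x ∈? ys
... | yes x∈ys =
  let zs , zs-unique , zs-fresh = ∃-unique-outside (suc n) xs (ys ─ x∈ys) xs-unique shorter
  in zs , zs-unique , VAll.map (λ (z∈xs , z∉ys─x) → there z∈xs , λ z∈ys →
       z∉ys─x (∈-─ x∈ys z∈ys (λ z≡x → LAll.lookup x≢xs z∈xs (sym z≡x)))) zs-fresh
  where
  shorter : suc n + length (ys ─ x∈ys) ≤ length xs
  shorter = s≤s⁻¹ (subst (_≤ suc (length xs))
    (trans (cong (suc n +_) (length-removeAt′ ys (index x∈ys))) (+-suc (suc n) _)) n+ys≤)
... | no x∉ys =
  let zs , zs-unique , zs-fresh = ∃-unique-outside n xs ys xs-unique (s≤s⁻¹ n+ys≤)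
  in x ∷ zs
   , ∉⇒All≢ (λ x∈zs → LAll.lookup x≢xs (proj₁ (VAll.lookup zs-fresh x∈zs)) refl) ∷ zs-unique
   , (here refl , x∉ys) ∷ VAll.map (λ (z∈xs , z∉ys) → there z∈xs , z∉ys) zs-fresh

Disjointᵥ : ∀ {p q} → Vec ℕ p → Vec ℕ q → Set
Disjointᵥ ws vs = ∀ {x} → x ∈ᵥ ws → x ∉ᵥ vs

perm-fix : ∀ {p} (ws vs : Vec ℕ p) {x} → x ∉ᵥ ws → x ∉ᵥ vs → perm ws vs x ≡ x
perm-fix [] [] _ _ = refl
perm-fix (w ∷ ws) (y ∷ vs) x∉ws x∉vs =
  trans (cong (swap w y) (perm-fix ws vs (x∉ws ∘ there) (x∉vs ∘ there))) (swap-fix (x∉ws ∘ here) (x∉vs ∘ here))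

perm-comm : ∀ {p} (ws vs : Vec ℕ p) x → perm ws vs x ≡ perm vs ws x
perm-comm [] [] _ = refl
perm-comm (w ∷ ws) (y ∷ vs) x = trans (cong (swap w y) (perm-comm ws vs x)) (swap-comm w y (perm vs ws x))

swap-fix-∈ : ∀ {n} {xs : Vec ℕ n} {a b z} → a ∉ᵥ xs → b ∉ᵥ xs → z ∈ᵥ xs → swap a b z ≡ z
swap-fix-∈ a∉xs b∉xs z∈xs =
  swap-fix (λ z≡a → a∉xs (subst (_∈ᵥ _) z≡a z∈xs)) (λ z≡b → b∉xs (subst (_∈ᵥ _) z≡b z∈xs))

disjoint-tail : ∀ {p q} {w y} {ws : Vec ℕ p} {vs : Vec ℕ q} → Disjointᵥ (w ∷ ws) (y ∷ vs) → Disjointᵥ ws vs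
disjoint-tail disjoint x∈ws x∈vs = disjoint (there x∈ws) (there x∈vs)

perm-∈ˡ : ∀ {p} {ws vs : Vec ℕ p} → Uniqueᵥ ws → Uniqueᵥ vs → Disjointᵥ ws vs →
  ∀ {x} → x ∈ᵥ ws → perm ws vs x ∈ᵥ vs
perm-∈ˡ {ws = w ∷ ws} {y ∷ vs} ws-unique _ disjoint (here refl) =
  here (trans (cong (swap w y) (perm-fix ws vs (head-∉ ws-unique) (disjoint (here refl) ∘ there))) (swap-ˡ w y))
perm-∈ˡ {ws = w ∷ ws} {y ∷ vs} (_ ∷ ws-unique) vs-unique@(_ ∷ vs-unique′) disjoint {x} (there x∈ws) =
  there (subst (_∈ᵥ vs) (sym (swap-fix-∈ (disjoint (here refl) ∘ there) (head-∉ vs-unique) π∈vs)) π∈vs)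
  where
  π∈vs : perm ws vs x ∈ᵥ vs
  π∈vs = perm-∈ˡ ws-unique vs-unique′ (disjoint-tail disjoint) x∈ws

perm-∈ʳ : ∀ {p} {ws vs : Vec ℕ p} → Uniqueᵥ ws → Uniqueᵥ vs → Disjointᵥ ws vs →
  ∀ {x} → x ∈ᵥ vs → perm ws vs x ∈ᵥ ws
perm-∈ʳ {ws = ws} {vs} ws-unique vs-unique disjoint {x} x∈vs =
  subst (_∈ᵥ ws) (sym (perm-comm ws vs x)) (perm-∈ˡ vs-unique ws-unique (λ x∈vs x∈ws → disjoint x∈ws x∈vs) x∈vs)

perm-involutive : ∀ {p} {ws vs : Vec ℕ p} → Uniqueᵥ ws → Uniqueᵥ vs → Disjointᵥ ws vs →
  ∀ x → perm ws vs (perm ws vs x) ≡ x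
perm-involutive {ws = []} {[]} _ _ _ _ = refl
perm-involutive {ws = w ∷ ws} {y ∷ vs} ws-unique@(_ ∷ ws-unique′) vs-unique@(_ ∷ vs-unique′) disjoint x = begin
  swap w y (π (swap w y (π x)))  ≡⟨ cong (swap w y) (swap-natural (involutive⇒injective IH) π-w π-y (π x)) ⟩
  swap w y (swap w y (π (π x)))  ≡⟨ swap-involutive w y _ ⟩
  π (π x)                        ≡⟨ IH x ⟩
  x                              ∎
  where
  open ≡-Reasoning
  π : ℕ → ℕ
  π = perm ws vs
  IH : ∀ x → π (π x) ≡ x
  IH = perm-involutive ws-unique′ vs-unique′ (disjoint-tail disjoint)
  π-w : π w ≡ w
  π-w = perm-fix ws vs (head-∉ ws-unique) (disjoint (here refl) ∘ there)
  π-y : π y ≡ y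
  π-y = perm-fix ws vs (λ y∈ws → disjoint (there y∈ws) (here refl)) (head-∉ vs-unique)

Sim-rel : ∀ {L} (N : Structure L) {a b} → Sim N a b →
  ∀ R ū → InDom N ū → rel N R (map (swap a b) ū) ≡ rel N R ū
Sim-rel N = proj₂ ∘ proj₂

swap-InDom : ∀ {L} (N : Structure L) {a b l} {ū : Vec ℕ l} →
  a ∈ dom N → b ∈ dom N → InDom N ū → InDom N (map (swap a b) ū)
swap-InDom N a∈N b∈N ū∈N = All-map⁺ (VAll.map (swap-preserves (_∈ dom N) a∈N b∈N) ū∈N)

Sim-refl : ∀ {L} (N : Structure L) {a} → a ∈ dom N → Sim N a a
Sim-refl N a∈N = a∈N , a∈N , λ R ū _ → cong (rel N R) (map-fix-∈ ū (λ {x} _ → swap-self _ x))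

Sim-sym : ∀ {L} (N : Structure L) {a b} → Sim N a b → Sim N b a
Sim-sym N {a} {b} a∼b@(a∈N , b∈N , _) = b∈N , a∈N , λ R ū ū∈N →
  trans (cong (rel N R) (map-cong-∈ ū (λ {x} _ → swap-comm b a x))) (Sim-rel N a∼b R ū ū∈N)

Sim-trans : ∀ {L} (N : Structure L) {a b c} → Sim N a b → Sim N b c → Sim N a c
Sim-trans N {a} {b} {c} a∼b b∼c with a ≟ b | b ≟ c | a ≟ c
... | yes refl | _ | _ = b∼c
... | no _ | yes refl | _ = a∼b
... | no _ | no _ | yes refl = Sim-refl N (proj₁ a∼b)
... | no a≢b | no b≢c | no a≢c = proj₁ a∼b , proj₁ (proj₂ b∼c) , λ R ū ū∈N → begin
  rel N R (map (swap a c) ū)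
    ≡⟨ cong (rel N R) (conjugated ū) ⟩
  rel N R (map (swap a b) (map (swap b c) (map (swap a b) ū)))
    ≡⟨ Sim-rel N a∼b R _ (swap-InDom N b∈N c∈N (swap-InDom N a∈N b∈N ū∈N)) ⟩
  rel N R (map (swap b c) (map (swap a b) ū))
    ≡⟨ Sim-rel N b∼c R _ (swap-InDom N a∈N b∈N ū∈N) ⟩
  rel N R (map (swap a b) ū)
    ≡⟨ Sim-rel N a∼b R ū ū∈N ⟩
  rel N R ū
    ∎
  where
  open ≡-Reasoning
  a∈N : a ∈ dom N
  a∈N = proj₁ a∼b
  b∈N : b ∈ dom N
  b∈N = proj₁ b∼c
  c∈N : c ∈ dom N
  c∈N = proj₁ (proj₂ b∼c)
  conjugated : ∀ {l} (ū : Vec ℕ l) → map (swap a c) ū ≡ map (swap a b) (map (swap b c) (map (swap a b) ū))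
  conjugated ū = trans (map-cong-∈ ū (λ {x} _ → swap-conjugate a≢b a≢c b≢c x))
    (trans (map-∘ (swap a b) _ ū) (cong (map (swap a b)) (map-∘ (swap b c) (swap a b) ū)))

InClass-Sim : ∀ {L} (N : Structure L) {v a b} → InClass N v a → InClass N v b → Sim N a b
InClass-Sim N (_ , a∼v) (_ , b∼v) = Sim-trans N a∼v (Sim-sym N b∼v)

Sim-restrict : ∀ {L} (K M : Structure L) → (∀ {u} → u ∈ dom M → u ∈ dom K) → AgreeOn K M →
  ∀ {a b} → a ∈ dom M → b ∈ dom M → Sim K a b → Sim M a b
Sim-restrict K M M⊆K agree {a} {b} a∈M b∈M a∼b = a∈M , b∈M , λ R ū ū∈M → begin
  rel M R (map (swap a b) ū)  ≡⟨ agree R _ (swap-InDom M a∈M b∈M ū∈M) ⟨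
  rel K R (map (swap a b) ū)  ≡⟨ Sim-rel K a∼b R ū (VAll.map M⊆K ū∈M) ⟩
  rel K R ū                   ≡⟨ agree R ū ū∈M ⟩
  rel M R ū                   ∎
  where open ≡-Reasoning

module _ {L} (N : Structure L) (P : ℕ → Set) (P-Sim : ∀ {a b} → P a → P b → Sim N a b)
         (R : Sym L) (ū : Vec ℕ (arity L R)) {g : ℕ → ℕ} (g-injective : InjectiveOn g ū) where

  record DiffersWithin (f : ℕ → ℕ) : Set where
    field
      image-in-dom : InDom N (map f ū)
      injective : InjectiveOn f ū
      differs-within : ∀ {x} → x ∈ᵥ ū → f x ≡ g x ⊎ P (f x) × P (g x)

  private module Repair {f} (f-differs : DiffersWithin f) {y} (y∈ū : y ∈ᵥ ū) (fy≢gy : f y ≢ g y) where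
    open DiffersWithin f-differs

    P-fy×P-gy : P (f y) × P (g y)
    P-fy×P-gy with differs-within y∈ū
    ... | inj₁ fy≡gy = ⊥-elim (fy≢gy fy≡gy)
    ... | inj₂ P-both = P-both

    fy∼gy : Sim N (f y) (g y)
    fy∼gy = P-Sim (proj₁ P-fy×P-gy) (proj₂ P-fy×P-gy)

    f′ : ℕ → ℕ
    f′ = swap (f y) (g y) ∘ f

    repaired : f′ y ≡ g y
    repaired = swap-ˡ (f y) (g y)

    agreement-kept : ∀ {x} → x ∈ᵥ ū → f x ≡ g x → f′ x ≡ g x
    agreement-kept {x} x∈ū fx≡gx = trans (swap-fix fx≢fy fx≢gy) fx≡gx
      where
      fx≢fy : f x ≢ f y
      fx≢fy fx≡fy = fy≢gy (subst (λ z → f z ≡ g z) (injective x∈ū y∈ū fx≡fy) fx≡gx)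
      fx≢gy : f x ≢ g y
      fx≢gy fx≡gy = fy≢gy (subst (λ z → f z ≡ g z) (g-injective x∈ū y∈ū (trans (sym fx≡gx) fx≡gy)) fx≡gx)

    f′-differs : DiffersWithin f′
    f′-differs = record
      { image-in-dom = subst (InDom N) (sym (map-∘ _ f ū))
          (swap-InDom N (proj₁ fy∼gy) (proj₁ (proj₂ fy∼gy)) image-in-dom)
      ; injective = λ x∈ū x′∈ū → injective x∈ū x′∈ū ∘ swap-injective (f y) (g y)
      ; differs-within = differs-within′
      }
      where
      differs-within′ : ∀ {x} → x ∈ᵥ ū → f′ x ≡ g x ⊎ P (f′ x) × P (g x)
      differs-within′ x∈ū with differs-within x∈ū
      ... | inj₁ fx≡gx = inj₁ (agreement-kept x∈ū fx≡gx)
      ... | inj₂ (P-fx , P-gx) = inj₂ (swap-preserves P (proj₁ P-fy×P-gy) (proj₂ P-fy×P-gy) P-fx , P-gx)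

    rel-f′ : rel N R (map f′ ū) ≡ rel N R (map f ū)
    rel-f′ = trans (cong (rel N R) (map-∘ _ f ū)) (Sim-rel N fy∼gy R (map f ū) image-in-dom)

  private
    agreement-beyond : ∀ {f f′ : ℕ → ℕ} {y m} {ys : Vec ℕ m} → f′ y ≡ g y →
      (∀ {x} → x ∈ᵥ ū → f x ≡ g x → f′ x ≡ g x) →
      (∀ {x} → x ∈ᵥ ū → x ∉ᵥ y ∷ ys → f x ≡ g x) →
      ∀ {x} → x ∈ᵥ ū → x ∉ᵥ ys → f′ x ≡ g x
    agreement-beyond {y = y} f′y≡gy kept agree {x} x∈ū x∉ys with x ≟ y
    ... | yes refl = f′y≡gy
    ... | no x≢y = kept x∈ū (agree x∈ū λ { (here x≡y) → x≢y x≡y ; (there x∈ys) → x∉ys x∈ys })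

    -- f may still disagree with g only at the pending entries; each step composes f with the
    -- transposition (f y  g y), an automorphism of N since both points satisfy P.
    rel-pending : ∀ {m} (pending : Vec ℕ m) → (∀ {x} → x ∈ᵥ pending → x ∈ᵥ ū) →
      ∀ {f} → DiffersWithin f → (∀ {x} → x ∈ᵥ ū → x ∉ᵥ pending → f x ≡ g x) →
      rel N R (map f ū) ≡ rel N R (map g ū)
    rel-pending [] _ _ agree = cong (rel N R) (map-cong-∈ ū (λ x∈ū → agree x∈ū λ ()))
    rel-pending (y ∷ ys) ⊆ū {f} f-differs agree with f y ≟ g y
    ... | yes fy≡gy = rel-pending ys (⊆ū ∘ there) f-differs (agreement-beyond fy≡gy (λ _ → id) agree)
    ... | no fy≢gy = trans (sym rel-f′)
          (rel-pending ys (⊆ū ∘ there) f′-differs (agreement-beyond repaired agreement-kept agree))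
      where open Repair f-differs (⊆ū (here refl)) fy≢gy

  rel-differsWithin : ∀ {f} → DiffersWithin f → rel N R (map f ū) ≡ rel N R (map g ū)
  rel-differsWithin f-differs = rel-pending ū id f-differs (λ x∈ū x∉ū → ⊥-elim (x∉ū x∈ū))

All-tabulate-∈ : ∀ {P : ℕ → Set} {l} {xs : Vec ℕ l} → (∀ {x} → x ∈ᵥ xs → P x) → VAll.All P xs
All-tabulate-∈ {xs = xs} h = lookup⁻ (λ i → h (∈-lookup i xs))

module _ {L} (M : Structure L) where

  NewEntries : ∀ {l p} → Vec ℕ l → Vec ℕ p → Set
  NewEntries ū ws = ∀ x → x ∈ᵥ ws ⇔ (x ∈ᵥ ū × x ∉ dom M)

  enumerate-new : ∀ {l} (ū : Vec ℕ l) → ∃ λ p → Σ (Vec ℕ p) λ ws → Uniqueᵥ ws × NewEntries ū ws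
  enumerate-new [] = 0 , [] , [] , λ _ → mk⇔ (λ ()) (λ ())
  enumerate-new (u ∷ ū) with enumerate-new ū
  ... | p , ws , ws-unique , ws-new with u ∈? dom M | u ∈ᵥ? ws
  ...   | yes u∈M | _ = p , ws , ws-unique , λ x → mk⇔ (Product.map₁ there ∘ to (ws-new x)) λ where
          (here refl , x∉M) → ⊥-elim (x∉M u∈M)
          (there x∈ū , x∉M) → from (ws-new x) (x∈ū , x∉M)
  ...   | no _ | yes u∈ws = p , ws , ws-unique , λ x → mk⇔ (Product.map₁ there ∘ to (ws-new x)) λ where
          (here refl , _) → u∈ws
          (there x∈ū , x∉M) → from (ws-new x) (x∈ū , x∉M)
  ...   | no u∉M | no u∉ws = suc p , u ∷ ws , ∉⇒All≢ u∉ws ∷ ws-unique , λ x → mk⇔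
          (λ where (here refl) → here refl , u∉M
                   (there x∈ws) → Product.map₁ there (to (ws-new x) x∈ws))
          (λ where (here refl , _) → here refl
                   (there x∈ū , x∉M) → there (from (ws-new x) (x∈ū , x∉M)))

module _ {L} (M : Structure L) (v : ℕ) where

  record IsRenaming {l} (ū : Vec ℕ l) (π : ℕ → ℕ) : Set where
    field
      fixes-old : ∀ {x} → x ∈ᵥ ū → x ∈ dom M → π x ≡ x
      new-into-class : ∀ {x} → x ∈ᵥ ū → x ∉ dom M → InClass M v (π x)
      injective : InjectiveOn π ū

  ClassOrNew : ℕ → Set
  ClassOrNew x = x ∉ dom M ⊎ InClass M v x

  FreshClassElements : ∀ {l p} → Vec ℕ l → Vec ℕ p → Set
  FreshClassElements ū vs = Uniqueᵥ vs × VAll.All (λ y → InClass M v y × y ∉ᵥ ū) vs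

  module _ {l} {ū : Vec ℕ l} {π : ℕ → ℕ} (π-renaming : IsRenaming ū π) where
    open IsRenaming π-renaming

    renaming-InDom : InDom M (map π ū)
    renaming-InDom = All-map⁺ (All-tabulate-∈ image∈M)
      where
      image∈M : ∀ {x} → x ∈ᵥ ū → π x ∈ dom M
      image∈M {x} x∈ū with x ∈? dom M
      ... | yes x∈M = subst (_∈ dom M) (sym (fixes-old x∈ū x∈M)) x∈M
      ... | no x∉M = proj₁ (new-into-class x∈ū x∉M)

    renaming-into-class : ∀ {x} → x ∈ᵥ ū → ClassOrNew x → InClass M v (π x)
    renaming-into-class x∈ū (inj₁ x∉M) = new-into-class x∈ū x∉M
    renaming-into-class x∈ū (inj₂ x∈class) = subst (InClass M v) (sym (fixes-old x∈ū (proj₁ x∈class))) x∈class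

  renamings-agree : ∀ R {ū : Vec ℕ (arity L R)} {π ρ} → IsRenaming ū π → IsRenaming ū ρ →
    rel M R (map π ū) ≡ rel M R (map ρ ū)
  renamings-agree R {ū} {π} {ρ} π-renaming ρ-renaming =
    rel-differsWithin M (InClass M v) (InClass-Sim M) R ū (IsRenaming.injective ρ-renaming) record
      { image-in-dom = renaming-InDom π-renaming
      ; injective = IsRenaming.injective π-renaming
      ; differs-within = differs-within
      }
    where
    differs-within : ∀ {x} → x ∈ᵥ ū → π x ≡ ρ x ⊎ InClass M v (π x) × InClass M v (ρ x)
    differs-within {x} x∈ū with x ∈? dom M
    ... | yes x∈M = inj₁ (trans (IsRenaming.fixes-old π-renaming x∈ū x∈M)
                                (sym (IsRenaming.fixes-old ρ-renaming x∈ū x∈M)))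
    ... | no x∉M = inj₂ (IsRenaming.new-into-class π-renaming x∈ū x∉M ,
                         IsRenaming.new-into-class ρ-renaming x∈ū x∉M)

  id-IsRenaming : ∀ {l} {ū : Vec ℕ l} → InDom M ū → IsRenaming ū id
  id-IsRenaming ū∈M = record
    { fixes-old = λ _ _ → refl
    ; new-into-class = λ x∈ū x∉M → ⊥-elim (x∉M (VAll.lookup ū∈M x∈ū))
    ; injective = λ _ _ → id
    }

  new-fresh-disjoint : ∀ {l p} {ū : Vec ℕ l} {ws vs : Vec ℕ p} → NewEntries M ū ws →
    FreshClassElements ū vs → Disjointᵥ ws vs
  new-fresh-disjoint ws-new (_ , vs-fresh) x∈ws x∈vs = proj₂ (VAll.lookup vs-fresh x∈vs) (proj₁ (to (ws-new _) x∈ws))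

  perm-IsRenaming : ∀ {l p} {ū : Vec ℕ l} {ws vs : Vec ℕ p} → Uniqueᵥ ws → NewEntries M ū ws →
    FreshClassElements ū vs → IsRenaming ū (perm ws vs)
  perm-IsRenaming {ū = ū} {ws} {vs} ws-unique ws-new vs-fresh@(vs-unique , vs-class-outside) = record
    { fixes-old = λ x∈ū x∈M → perm-fix ws vs (λ x∈ws → proj₂ (to (ws-new _) x∈ws) x∈M)
        (λ x∈vs → proj₂ (VAll.lookup vs-class-outside x∈vs) x∈ū)
    ; new-into-class = λ x∈ū x∉M →
        proj₁ (VAll.lookup vs-class-outside (perm-∈ˡ ws-unique vs-unique disjoint (from (ws-new _) (x∈ū , x∉M))))
    ; injective = λ _ _ → involutive⇒injective (perm-involutive ws-unique vs-unique disjoint)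
    }
    where
    disjoint : Disjointᵥ ws vs
    disjoint = new-fresh-disjoint ws-new vs-fresh

  fresh-class-elements : ∀ {l p} {ū : Vec ℕ l} {ws : Vec ℕ p} (enough : AtLeast l (InClass M v)) →
    Uniqueᵥ ws → NewEntries M ū ws →
    Σ (Vec ℕ p) λ vs → FreshClassElements ū vs × VAll.All (_∈ proj₁ enough) vs
  fresh-class-elements {l} {p} {ū} {ws} (Cl , Cl-unique , Cl-class , l≤Cl) ws-unique ws-new =
    let vs , vs-unique , vs-outside = ∃-unique-outside p (Cl ++ toList ws) (toList ū) candidates-unique enough-candidates
        vs-in-Cl = VAll.map in-Cl vs-outside
    in vs , (vs-unique , VAll.map (Product.map₁ (LAll.lookup Cl-class)) vs-in-Cl) , VAll.map proj₁ vs-in-Cl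
    where
    ws-∉M : ∀ {z} → z ∈ toList ws → z ∉ dom M
    ws-∉M z∈ws = proj₂ (to (ws-new _) (∈-toList⁻ z∈ws))

    candidates-unique : Unique (Cl ++ toList ws)
    candidates-unique = Unique.++⁺ Cl-unique (Unique-toList ws-unique)
      (λ (z∈Cl , z∈ws) → ws-∉M z∈ws (proj₁ (LAll.lookup Cl-class z∈Cl)))

    enough-candidates : p + length (toList ū) ≤ length (Cl ++ toList ws)
    enough-candidates = begin
      p + length (toList ū)          ≡⟨ cong (p +_) (length-toList ū) ⟩
      p + l                          ≡⟨ +-comm p l ⟩
      l + p                          ≤⟨ +-monoˡ-≤ p l≤Cl ⟩
      length Cl + p                  ≡⟨ cong (length Cl +_) (length-toList ws) ⟨
      length Cl + length (toList ws) ≡⟨ length-++ Cl ⟨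
      length (Cl ++ toList ws)       ∎
      where open ≤-Reasoning

    in-Cl : ∀ {z} → z ∈ Cl ++ toList ws × z ∉ toList ū → z ∈ Cl × z ∉ᵥ ū
    in-Cl (z∈Cl++ws , z∉ū) with ∈-++⁻ Cl z∈Cl++ws
    ... | inj₁ z∈Cl = z∈Cl , z∉ū ∘ ∈-toList⁺
    ... | inj₂ z∈ws = ⊥-elim (z∉ū (∈-toList⁺ (proj₁ (to (ws-new _) (∈-toList⁻ z∈ws)))))

  ∃-renaming : ∀ {l} (ū : Vec ℕ l) → AtLeast l (InClass M v) → ∃ (IsRenaming ū)
  ∃-renaming ū enough =
    let _ , ws , ws-unique , ws-new = enumerate-new M ū
        _ , vs-fresh , _ = fresh-class-elements enough ws-unique ws-new
    in _ , perm-IsRenaming ws-unique ws-new vs-fresh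

DeterminedByRenamings : ∀ {L} (K M : Structure L) → ℕ → Set
DeterminedByRenamings {L} K M v = ∀ (R : Sym L) (ū : Vec ℕ (arity L R)) → InDom K ū →
  ∀ {π} → IsRenaming M v ū π → rel K R ū ≡ rel M R (map π ū)

CondD : ∀ {L} → ℕ → (K M : Structure L) → ℕ → ℕ → Set
CondD k K M v t = Extends K M t × AtLeast k (InClass M v) × DeterminedByRenamings K M v

module Conditions {L k} (max-arity : MaxArity L k) (K M : Structure L) (v : ℕ) where

  private
    enough-for : AtLeast k (InClass M v) → ∀ R → AtLeast (arity L R) (InClass M v)
    enough-for (Cl , Cl-unique , Cl-class , k≤Cl) R = Cl , Cl-unique , Cl-class , ≤-trans (proj₁ max-arity R) k≤Cl

  determined⇒AgreeOn : (∀ {u} → u ∈ dom M → u ∈ dom K) → DeterminedByRenamings K M v → AgreeOn K M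
  determined⇒AgreeOn M⊆K determined R ū ū∈M =
    trans (determined R ū (VAll.map M⊆K ū∈M) (id-IsRenaming M v ū∈M)) (cong (rel M R) (map-id ū))

  condA⇒condB : ∀ {t} → CondA k K M v t → CondB k K M v t
  condA⇒condB (extends , agree , (Cl , Cl-unique , Cl-class , k≤Cl) , classK) =
    extends , Cl , Cl-unique , Cl-class , k≤Cl , λ ψ ψ-into ψ-injective ψ-fixes →
      LAll.tabulate id , ψ-into , ψ-injective , λ R ū ū∈M →
        let ψ-differs = record
              { image-in-dom = All-map⁺ (VAll.map ψ-into ū∈M)
              ; injective = λ x∈ū y∈ū → ψ-injective (VAll.lookup ū∈M x∈ū) (VAll.lookup ū∈M y∈ū)
              ; differs-within = λ x∈ū → differs-within ψ ψ-into ψ-injective ψ-fixes (VAll.lookup ū∈M x∈ū)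
              }
        in trans (rel-differsWithin K (InClass K v) (InClass-Sim K) R ū (λ _ _ → id) ψ-differs)
             (trans (cong (rel K R) (map-id ū)) (agree R ū ū∈M))
    where
    into-classK : ∀ {u} → InClass M v u ⊎ (u ∈ dom K × u ∉ dom M) → InClass K v u
    into-classK = from (classK _)

    Cl⊆classK : ∀ {x} → x ∈ Cl → InClass K v x
    Cl⊆classK x∈Cl = into-classK (inj₁ (LAll.lookup Cl-class x∈Cl))

    -- An element of Cl cannot be mapped onto a point of V(M) ∖ Cl, since ψ already fixes that point.
    differs-within : ∀ ψ → (∀ {u} → u ∈ dom M → ψ u ∈ dom K) →
      (∀ {u u′} → u ∈ dom M → u′ ∈ dom M → ψ u ≡ ψ u′ → u ≡ u′) →
      (∀ {u} → u ∈ dom M → u ∉ Cl → ψ u ≡ u) →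
      ∀ {x} → x ∈ dom M → ψ x ≡ x ⊎ InClass K v (ψ x) × InClass K v x
    differs-within ψ ψ-into ψ-injective ψ-fixes {x} x∈M with x ∈? Cl
    ... | no x∉Cl = inj₁ (ψ-fixes x∈M x∉Cl)
    ... | yes x∈Cl = inj₂ (ψx∈classK , Cl⊆classK x∈Cl)
      where
      ψx∈classK : InClass K v (ψ x)
      ψx∈classK with ψ x ∈? dom M | ψ x ∈? Cl
      ... | no ψx∉M | _ = into-classK (inj₂ (ψ-into x∈M , ψx∉M))
      ... | yes _ | yes ψx∈Cl = Cl⊆classK ψx∈Cl
      ... | yes ψx∈M | no ψx∉Cl =
        ⊥-elim (ψx∉Cl (subst (_∈ Cl) (sym (ψ-injective ψx∈M x∈M (ψ-fixes ψx∈M ψx∉Cl))) x∈Cl))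

  condB⇒condD : ∀ {t} → CondB k K M v t → CondD k K M v t
  condB⇒condD (extends@(M⊆K , _) , Cl , Cl-unique , Cl-class , k≤Cl , partial-iso) =
    extends , enough , determined
    where
    enough : AtLeast k (InClass M v)
    enough = Cl , Cl-unique , Cl-class , k≤Cl

    -- σ is admissible in (B) because vs ⊆ Cl, and as an involution it recovers ū from σ ū.
    determined : DeterminedByRenamings K M v
    determined R ū ū∈K {π} π-renaming with enumerate-new M ū
    ... | _ , ws , ws-unique , ws-new with fresh-class-elements M v (enough-for enough R) ws-unique ws-new
    ...   | vs , vs-fresh , vs⊆Cl = begin
      rel K R ū                  ≡⟨ cong (rel K R) σσū≡ū ⟨
      rel K R (map σ (map σ ū))  ≡⟨ proj₂ (proj₂ (proj₂ σ-iso)) R (map σ ū) (renaming-InDom M v σ-renaming) ⟩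
      rel M R (map σ ū)          ≡⟨ renamings-agree M v R σ-renaming π-renaming ⟩
      rel M R (map π ū)          ∎
      where
      open ≡-Reasoning
      σ : ℕ → ℕ
      σ = perm ws vs
      σ-renaming : IsRenaming M v ū σ
      σ-renaming = perm-IsRenaming M v ws-unique ws-new vs-fresh
      disjoint : Disjointᵥ ws vs
      disjoint = new-fresh-disjoint M v ws-new vs-fresh
      σ-involutive : ∀ x → σ (σ x) ≡ x
      σ-involutive = perm-involutive ws-unique (proj₁ vs-fresh) disjoint
      σσū≡ū : map σ (map σ ū) ≡ ū
      σσū≡ū = trans (sym (map-∘ σ σ ū)) (map-fix-∈ ū (λ {x} _ → σ-involutive x))
      σ-injective : ∀ {u u′} → u ∈ dom M → u′ ∈ dom M → σ u ≡ σ u′ → u ≡ u′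
      σ-injective _ _ = involutive⇒injective σ-involutive
      old∉ws : ∀ {u} → u ∈ dom M → u ∉ᵥ ws
      old∉ws u∈M u∈ws = proj₂ (to (ws-new _) u∈ws) u∈M
      σ-fixes : ∀ {u} → u ∈ dom M → u ∉ Cl → σ u ≡ u
      σ-fixes u∈M u∉Cl = perm-fix ws vs (old∉ws u∈M) (u∉Cl ∘ VAll.lookup vs⊆Cl)
      σ-into : ∀ {u} → u ∈ dom M → σ u ∈ dom K
      σ-into {u} u∈M with u ∈ᵥ? vs
      ... | yes u∈vs = VAll.lookup ū∈K (proj₁ (to (ws-new _) (perm-∈ʳ ws-unique (proj₁ vs-fresh) disjoint u∈vs)))
      ... | no u∉vs = subst (_∈ dom K) (sym (perm-fix ws vs (old∉ws u∈M) u∉vs)) (M⊆K u∈M)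
      σ-iso : PartialIso M K (dom M) σ
      σ-iso = partial-iso σ σ-into σ-injective σ-fixes

  condD⇒condC : ∀ {t} → CondD k K M v t → CondC k K M v t
  condD⇒condC (extends , enough , determined) =
    extends , enough , determined⇒AgreeOn (proj₁ extends) determined ,
    λ R ū ū∈K p ws ws-distinct ws-new _ →
      let ws-unique = Distinct⇒Unique ws-distinct
          vs , vs-fresh , _ = fresh-class-elements M v (enough-for enough R) ws-unique ws-new
      in mk⇔ (λ relK → vs , Unique⇒Distinct (proj₁ vs-fresh) , proj₂ vs-fresh ,
                         trans (sym (determined R ū ū∈K (perm-IsRenaming M v ws-unique ws-new vs-fresh))) relK)
             (λ (vs′ , vs′-distinct , vs′-class-outside , relM) →
                trans (determined R ū ū∈K
                  (perm-IsRenaming M v ws-unique ws-new (Distinct⇒Unique vs′-distinct , vs′-class-outside))) relM)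

  condC⇒condD : ∀ {t} → CondC k K M v t → CondD k K M v t
  condC⇒condD (extends , enough , agree , new-entries-rule) = extends , enough , determined
    where
    determined : DeterminedByRenamings K M v
    determined R ū ū∈K {π} π-renaming with enumerate-new M ū
    ... | zero , [] , _ , ws-new = begin
      rel K R ū          ≡⟨ agree R ū ū∈M ⟩
      rel M R ū          ≡⟨ cong (rel M R) (map-fix-∈ ū (λ x∈ū → IsRenaming.fixes-old π-renaming x∈ū (old x∈ū))) ⟨
      rel M R (map π ū)  ∎
      where
      open ≡-Reasoning
      old : ∀ {x} → x ∈ᵥ ū → x ∈ dom M
      old {x} x∈ū with x ∈? dom M
      ... | yes x∈M = x∈M
      ... | no x∉M with () ← from (ws-new x) (x∈ū , x∉M)
      ū∈M : InDom M ū
      ū∈M = All-tabulate-∈ old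
    ... | suc p , ws , ws-unique , ws-new
        with new-entries-rule R ū ū∈K (suc p) ws (Unique⇒Distinct ws-unique) ws-new (s≤s z≤n)
           | fresh-class-elements M v (enough-for enough R) ws-unique ws-new
    ...   | rule | vs , vs-fresh , _ = ⇔→≡ (mk⇔
      (λ relK → let vs′ , vs′-distinct , vs′-class-outside , relM = to rule relK
                in trans (renamings-agree M v R π-renaming
                           (perm-renaming (Distinct⇒Unique vs′-distinct , vs′-class-outside))) relM)
      (λ relM → from rule (vs , Unique⇒Distinct (proj₁ vs-fresh) , proj₂ vs-fresh ,
                           trans (renamings-agree M v R (perm-renaming vs-fresh) π-renaming) relM)))
      where
      perm-renaming : ∀ {vs} → FreshClassElements M v ū vs → IsRenaming M v ū (perm ws vs)
      perm-renaming = perm-IsRenaming M v ws-unique ws-new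

  classOrNew⇒Sim : (∀ {u} → u ∈ dom M → u ∈ dom K) → AtLeast k (InClass M v) → DeterminedByRenamings K M v →
    v ∈ dom M → ∀ {u} → u ∈ dom K → ClassOrNew M v u → Sim K u v
  classOrNew⇒Sim M⊆K enough determined v∈M {u} u∈K u-class-or-new = u∈K , M⊆K v∈M , λ R ū ū∈K →
    swap-invariant R ū ū∈K (∃-renaming M v ū (enough-for enough R)) (∃-renaming M v (map s ū) (enough-for enough R))
    where
    s : ℕ → ℕ
    s = swap u v

    v-class-or-new : ClassOrNew M v v
    v-class-or-new = inj₂ (v∈M , Sim-refl M v∈M)

    swap-invariant : ∀ R ū → InDom K ū → ∃ (IsRenaming M v ū) → ∃ (IsRenaming M v (map s ū)) →
      rel K R (map s ū) ≡ rel K R ū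
    swap-invariant R ū ū∈K (π , π-renaming) (ρ , ρ-renaming) = begin
      rel K R (map s ū)          ≡⟨ determined R (map s ū) (swap-InDom K u∈K (M⊆K v∈M) ū∈K) ρ-renaming ⟩
      rel M R (map ρ (map s ū))  ≡⟨ cong (rel M R) (map-∘ ρ s ū) ⟨
      rel M R (map (ρ ∘ s) ū)    ≡⟨ rel-differsWithin M (InClass M v) (InClass-Sim M) R ū
                                      (IsRenaming.injective π-renaming) ρs-differs ⟩
      rel M R (map π ū)          ≡⟨ determined R ū ū∈K π-renaming ⟨
      rel K R ū                  ∎
      where
      open ≡-Reasoning

      both-in-class : ∀ {x} → x ∈ᵥ ū → ClassOrNew M v x → InClass M v (ρ (s x)) × InClass M v (π x)
      both-in-class x∈ū x-class-or-new =
        renaming-into-class M v ρ-renaming (∈-map⁺ s x∈ū)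
          (swap-preserves (ClassOrNew M v) u-class-or-new v-class-or-new x-class-or-new) ,
        renaming-into-class M v π-renaming x∈ū x-class-or-new

      differs-within : ∀ {x} → x ∈ᵥ ū → ρ (s x) ≡ π x ⊎ InClass M v (ρ (s x)) × InClass M v (π x)
      differs-within {x} x∈ū with x ∈? dom M | x ≟ u | x ≟ v
      ... | no x∉M | _ | _ = inj₂ (both-in-class x∈ū (inj₁ x∉M))
      ... | yes _ | yes refl | _ = inj₂ (both-in-class x∈ū u-class-or-new)
      ... | yes _ | no _ | yes refl = inj₂ (both-in-class x∈ū v-class-or-new)
      ... | yes x∈M | no x≢u | no x≢v = inj₁ (begin
        ρ (s x)  ≡⟨ cong ρ sx≡x ⟩
        ρ x      ≡⟨ IsRenaming.fixes-old ρ-renaming (subst (_∈ᵥ map s ū) sx≡x (∈-map⁺ s x∈ū)) x∈M ⟩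
        x        ≡⟨ IsRenaming.fixes-old π-renaming x∈ū x∈M ⟨
        π x      ∎)
        where
        sx≡x : s x ≡ x
        sx≡x = swap-fix x≢u x≢v

      ρs-differs : DiffersWithin M (InClass M v) (InClass-Sim M) R ū (IsRenaming.injective π-renaming) (ρ ∘ s)
      ρs-differs = record
        { image-in-dom = subst (InDom M) (sym (map-∘ ρ s ū)) (renaming-InDom M v ρ-renaming)
        ; injective = λ x∈ū y∈ū →
            swap-injective u v ∘ IsRenaming.injective ρ-renaming (∈-map⁺ s x∈ū) (∈-map⁺ s y∈ū)
        ; differs-within = differs-within
        }

  condD⇒condA : ∀ {t} → v ∈ dom M → CondD k K M v t → CondA k K M v t
  condD⇒condA v∈M (extends@(M⊆K , _) , enough , determined) =
    extends , agree , enough , λ u → mk⇔ (classK⇒ u) (⇒classK u)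
    where
    agree : AgreeOn K M
    agree = determined⇒AgreeOn M⊆K determined

    classK⇒ : ∀ u → InClass K v u → InClass M v u ⊎ (u ∈ dom K × u ∉ dom M)
    classK⇒ u (u∈K , u∼v) with u ∈? dom M
    ... | yes u∈M = inj₁ (u∈M , Sim-restrict K M M⊆K agree u∈M v∈M u∼v)
    ... | no u∉M = inj₂ (u∈K , u∉M)

    ⇒classK : ∀ u → InClass M v u ⊎ (u ∈ dom K × u ∉ dom M) → InClass K v u
    ⇒classK u (inj₁ u∈class) = u∈K , classOrNew⇒Sim M⊆K enough determined v∈M u∈K (inj₂ u∈class)
      where
      u∈K : u ∈ dom K
      u∈K = M⊆K (proj₁ u∈class)
    ⇒classK u (inj₂ (u∈K , u∉M)) = u∈K , classOrNew⇒Sim M⊆K enough determined v∈M u∈K (inj₁ u∉M)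

lemma4p6 : (L : Vocabulary) (k : ℕ) → MaxArity L k →
    (K M : Structure L) (v : ℕ) → v ∈ dom M → (t : ℕ) →
    (CondA k K M v t ⇔ CondB k K M v t) × (CondB k K M v t ⇔ CondC k K M v t)
lemma4p6 L k max-arity K M v v∈M t =
  mk⇔ condA⇒condB (condD⇒condA v∈M ∘ condB⇒condD) ,
  mk⇔ (condD⇒condC ∘ condB⇒condD) (condA⇒condB ∘ condD⇒condA v∈M ∘ condC⇒condD)
  where open Conditions max-arity K M v
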